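{- Let $\varGamma$ be a finite simple connected graph, let $C$ be a neighbour-transitive code with minimum distance $\delta$ in $\varGamma$, let $G\leq\mathrm{Aut}(\varGamma)$ with $\mathrm{Aut}(C)\leq G$, and let $\iota$ be a $G$-invariant map on the vertex set of $\varGamma$. Then: (1) for $i\in\{0,1\}$, all vertices in $C_i$ have the same type; (2) if $\alpha\in C$ and $\beta\in C_1$, then every vertex in $\varGamma_1(\alpha)$ has the same type as $\alpha$ or as $\beta$; (3) if $\delta\geq 2$ and $\alpha\in C$, then every pair of vertices in $\varGamma_1(\alpha)$ have the same type.
   Context: A code $C$ in $\varGamma$ is a subset of the vertex set with $|C|\geq 2$. Writing $d$ for graph distance, the minimum distance $\delta$ is the least distance between distinct codewords; $C_0=C$ and $C_1$ is the set of vertices $\gamma$ with $\min_{\alpha\in C}d(\alpha,\gamma)=1$; $\varGamma_1(\alpha)$ is the set of neighbours of $\alpha$. $\mathrm{Aut}(C)$ is the setwise stabiliser of $C$ in $\mathrm{Aut}(\varGamma)$. $C$ is neighbour-transitive if $C_1\neq\emptyset$ and $\mathrm{Aut}(C)$ is transitive on $C$ and on $C_1$. For a group $G$ acting on a set $X$, a $G$-invariant map on $X$ is a map $\iota:X\to S$ (some set $S$) with $\iota(x^g)=\iota(x)$ for all $x\in X$, $g\in G$; the type of $x$ is $\iota(x)$. -}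

module Defs where

open import Data.Nat using (ℕ; zero; suc; _≤_)
open import Data.Bool using (Bool; T)
open import Data.Fin using (Fin)
open import Data.Fin.Subset using (Subset; _∈_; _∉_; ∣_∣)
open import Data.Fin.Permutation using (Permutation′; _⟨$⟩ʳ_; _≈_; id; flip; _∘ₚ_)
open import Data.Product using (Σ; ∃; ∃-syntax; _×_; _,_)
open import Relation.Binary.PropositionalEquality using (_≡_; _≢_)
open import Relation.Nullary using (¬_)
open import Function.Bundles using (_⇔_)
open import Level using (Level; suc; _⊔_) renaming (zero to 0ℓ)

record Graph (n : ℕ) : Set where
  field
    E     : Fin n → Fin n → Bool
    sym   : ∀ u v → E u v ≡ E v u
    irrefl : ∀ u → ¬ T (E u u)

module _ {n : ℕ} (Γ : Graph n) where
  open Graph Γ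

  Adj : Fin n → Fin n → Set
  Adj u v = T (E u v)

  data Walk : ℕ → Fin n → Fin n → Set where
    here : ∀ {u} → Walk zero u u
    step : ∀ {k u w v} → Adj u w → Walk k w v → Walk (ℕ.suc k) u v

  Connected : Set
  Connected = ∀ u v → ∃[ k ] Walk k u v

  Dist : Fin n → Fin n → ℕ → Set
  Dist u v k = Walk k u v × (∀ m → Walk m u v → k ≤ m)

  IsCode : Subset n → Set
  IsCode C = 2 ≤ ∣ C ∣

  Γ₁ : Fin n → Fin n → Set
  Γ₁ α γ = Adj α γ

  C₁ : Subset n → Fin n → Set
  C₁ C γ = (∃[ α ] (α ∈ C × Dist α γ 1))
         × (∀ α k → α ∈ C → Dist α γ k → 1 ≤ k)

  MinDist≥2 : Subset n → Set
  MinDist≥2 C = ∀ α β k → α ∈ C → β ∈ C → α ≢ β → Dist α β k → 2 ≤ k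

  IsAut : Permutation′ n → Set
  IsAut σ = ∀ u v → Adj u v ⇔ Adj (σ ⟨$⟩ʳ u) (σ ⟨$⟩ʳ v)

  InAutC : Subset n → Permutation′ n → Set
  InAutC C σ = IsAut σ × (∀ x → (x ∈ C) ⇔ ((σ ⟨$⟩ʳ x) ∈ C))

  NeighbourTransitive : Subset n → Set
  NeighbourTransitive C =
      (∃[ γ ] C₁ C γ)
    × (∀ α β → α ∈ C → β ∈ C → ∃[ σ ] (InAutC C σ × σ ⟨$⟩ʳ α ≡ β))
    × (∀ α β → C₁ C α → C₁ C β → ∃[ σ ] (InAutC C σ × σ ⟨$⟩ʳ α ≡ β))

  record IsSubgroupOfAut {ℓ : Level} (G : Permutation′ n → Set ℓ) : Set ℓ where
    field
      ⊆Aut     : ∀ σ → G σ → IsAut σ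
      resp-≈   : ∀ σ τ → σ ≈ τ → G σ → G τ
      has-id   : G id
      closed-∘ : ∀ σ τ → G σ → G τ → G (σ ∘ₚ τ)
      closed-⁻¹ : ∀ σ → G σ → G (flip σ)

Invariant : ∀ {n ℓ s} {S : Set s} (G : Permutation′ n → Set ℓ) → (Fin n → S) → Set (ℓ ⊔ s)
Invariant G ι = ∀ g x → G g → ι (g ⟨$⟩ʳ x) ≡ ι x

-- Types are constant on orbits of G, and Aut(C) ≤ G is transitive on C and on C₁;
-- this gives (1).  A neighbour of a codeword is either a codeword or lies in C₁,
-- which gives (2); when δ ≥ 2 it cannot be a codeword, which gives (3).
module Submission where

open import Defs
open import Data.Nat using (ℕ; zero; suc; s≤s; z≤n; _≤_)
open import Data.Fin using (Fin)
open import Data.Fin.Subset using (Subset; _∈_; _∉_)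
open import Data.Fin.Subset.Properties using (_∈?_)
open import Data.Fin.Permutation using (Permutation′; _⟨$⟩ʳ_)
open import Data.Product using (∃-syntax; _×_; _,_)
open import Data.Sum using (_⊎_; inj₁; inj₂)
open import Data.Empty using (⊥-elim)
open import Relation.Nullary using (yes; no)
open import Relation.Binary.PropositionalEquality using (_≡_; _≢_; refl; sym; subst)
open import Level using (Level)

module _ {n : ℕ} (Γ : Graph n) where

  walk-zero⇒≡ : ∀ {u v} → Walk Γ zero u v → u ≡ v
  walk-zero⇒≡ here = refl

  adj⇒≢ : ∀ {u v} → Adj Γ u v → u ≢ v
  adj⇒≢ {u} a refl = Graph.irrefl Γ u a

  adj⇒dist1 : ∀ {u v} → Adj Γ u v → Dist Γ u v 1
  adj⇒dist1 a = step a here , λ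
    { zero    w → ⊥-elim (adj⇒≢ a (walk-zero⇒≡ w))
    ; (suc m) _ → s≤s z≤n
    }

  adj-∉⇒C₁ : ∀ {C α γ} → α ∈ C → Adj Γ α γ → γ ∉ C → C₁ Γ C γ
  adj-∉⇒C₁ {C} {α} {γ} α∈C a γ∉C = (α , α∈C , adj⇒dist1 a) , positive
    where
    positive : ∀ α′ k → α′ ∈ C → Dist Γ α′ γ k → 1 ≤ k
    positive α′ zero α′∈C (w , _) = ⊥-elim (γ∉C (subst (_∈ C) (walk-zero⇒≡ w) α′∈C))
    positive α′ (suc k) _ _ = s≤s z≤n

  MinDist≥2⇒adj-∉ : ∀ {C α γ} → MinDist≥2 Γ C → α ∈ C → Adj Γ α γ → γ ∉ C
  MinDist≥2⇒adj-∉ {α = α} {γ} δ≥2 α∈C a γ∈C with δ≥2 α γ 1 α∈C γ∈C (adj⇒≢ a) (adj⇒dist1 a)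
  ... | s≤s ()

invariant-constant-on-orbit :
  ∀ {n ℓ h s} {S : Set s} {G : Permutation′ n → Set ℓ} {H : Permutation′ n → Set h}
    {P : Fin n → Set} {ι : Fin n → S} →
  Invariant G ι → (∀ σ → H σ → G σ) →
  (∀ α β → P α → P β → ∃[ σ ] (H σ × σ ⟨$⟩ʳ α ≡ β)) →
  ∀ α β → P α → P β → ι α ≡ ι β
invariant-constant-on-orbit inv H⊆G transitive α β Pα Pβ
  with transitive α β Pα Pβ
... | σ , σ∈H , refl = sym (inv σ α (H⊆G σ σ∈H))

lemma2p2 : ∀ {n : ℕ} {ℓ s : Level} (Γ : Graph n) → Connected Γ →
    (C : Subset n) → IsCode Γ C → NeighbourTransitive Γ C →
    (G : Permutation′ n → Set ℓ) → IsSubgroupOfAut Γ G →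
    (∀ σ → InAutC Γ C σ → G σ) →
    {S : Set s} (ι : Fin n → S) → Invariant G ι →
      ((∀ α β → α ∈ C → β ∈ C → ι α ≡ ι β)
       × (∀ α β → C₁ Γ C α → C₁ Γ C β → ι α ≡ ι β))
    × (∀ α β γ → α ∈ C → C₁ Γ C β → Γ₁ Γ α γ → (ι γ ≡ ι α) ⊎ (ι γ ≡ ι β))
    × (MinDist≥2 Γ C → ∀ α γ γ′ → α ∈ C → Γ₁ Γ α γ → Γ₁ Γ α γ′ → ι γ ≡ ι γ′)
lemma2p2 Γ _ C _ (_ , transitive-C , transitive-C₁) G _ AutC⊆G ι inv =
  (type-C , type-C₁) , neighbour-type , neighbours-same-type
  where
  type-C : ∀ α β → α ∈ C → β ∈ C → ι α ≡ ι β
  type-C = invariant-constant-on-orbit inv AutC⊆G transitive-C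

  type-C₁ : ∀ α β → C₁ Γ C α → C₁ Γ C β → ι α ≡ ι β
  type-C₁ = invariant-constant-on-orbit inv AutC⊆G transitive-C₁

  neighbour-type : ∀ α β γ → α ∈ C → C₁ Γ C β → Γ₁ Γ α γ → (ι γ ≡ ι α) ⊎ (ι γ ≡ ι β)
  neighbour-type α β γ α∈C β∈C₁ a with γ ∈? C
  ... | yes γ∈C = inj₁ (type-C γ α γ∈C α∈C)
  ... | no  γ∉C = inj₂ (type-C₁ γ β (adj-∉⇒C₁ Γ α∈C a γ∉C) β∈C₁)

  neighbours-same-type : MinDist≥2 Γ C → ∀ α γ γ′ → α ∈ C → Γ₁ Γ α γ → Γ₁ Γ α γ′ → ι γ ≡ ι γ′
  neighbours-same-type δ≥2 α γ γ′ α∈C a a′ =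
    type-C₁ γ γ′ (in-C₁ a) (in-C₁ a′)
    where
    in-C₁ : ∀ {v} → Adj Γ α v → C₁ Γ C v
    in-C₁ av = adj-∉⇒C₁ Γ α∈C av (MinDist≥2⇒adj-∉ Γ δ≥2 α∈C av)
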